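{- If a graph $G$ has a $4$-OCDC, then $\Phi_2^1(G)=\Phi_2^\infty(G)=2$.
   Context: A cycle in a graph is a (possibly empty) subgraph in which every vertex has even degree. An oriented cycle is a cycle together with an orientation of its edges such that each vertex has equal indegree and outdegree. A $4$-OCDC of $G$ is a multiset of $4$ oriented cycles such that each edge of $G$ occurs in each of its two orientations in exactly one of the cycles. An $\mathbb{R}^2$-flow on $G=(V,E)$ consists of an orientation of the edges and a map $\varphi\colon E\to\mathbb{R}^2$ satisfying flow conservation at every vertex. For real $r\ge2$, an $(r,2)$-MNZF (resp. $(r,2)$-ChNZF) is an $\mathbb{R}^2$-flow with $1\le\|\varphi(e)\|_1\le r-1$ (resp. $1\le\|\varphi(e)\|_\infty\le r-1$) for every edge, with $\|\cdot\|_1$ the Manhattan and $\|\cdot\|_\infty$ the Chebyshev norm; $\Phi_2^1(G)$ (resp. $\Phi_2^\infty(G)$) is the infimum of all $r\ge 2$ for which such a flow exists.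
   Formalization: The flow values are taken in ℚ² instead of ℝ², and the parameter r ranges over the rationals rather than the reals. -}

module Defs where

open import Data.Nat using (ℕ; zero; suc)
open import Data.Fin using (Fin; zero; suc)
open import Data.Bool using (Bool; true; false; if_then_else_)
open import Data.Product using (Σ; ∃; _×_; _,_)
open import Data.Integer as ℤ using (ℤ)
open import Data.Rational as ℚ using (ℚ; 0ℚ; 1ℚ; _+_; _-_; ∣_∣; _⊔_; _≤_; _<_)
open import Relation.Binary.PropositionalEquality using (_≡_)
open import Relation.Nullary using (Dec; yes; no)
open import Data.Fin using (_≟_)

-- Every edge e has two ends 'tail e' and 'head e';
-- this is only a reference labelling of the ends, not part of the structure
-- that the notions below depend on (all orientations are quantified over).
record Graph : Set where
  field
    n    : ℕ
    m    : ℕ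
    tail : Fin m → Fin n
    head : Fin m → Fin n
open Graph public

sumℤ : ∀ {k} → (Fin k → ℤ) → ℤ
sumℤ {zero}  f = ℤ.0ℤ
sumℤ {suc k} f = f zero ℤ.+ sumℤ (λ i → f (suc i))

sumℚ : ∀ {k} → (Fin k → ℚ) → ℚ
sumℚ {zero}  f = 0ℚ
sumℚ {suc k} f = f zero + sumℚ (λ i → f (suc i))

[_≟ᵛ_] : ∀ {n} → Fin n → Fin n → Bool
[ u ≟ᵛ v ] with u ≟ v
... | yes _ = true
... | no  _ = false

-- Status of an edge in an oriented subgraph: absent, present with the
-- reference direction (tail → head), or present with the reverse direction.
data Dir : Set where
  absent fwd bwd : Dir

outMinusIn : (G : Graph) → (Fin (m G) → Dir) → Fin (n G) → Fin (m G) → ℤ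
outMinusIn G C v e with C e
... | absent = ℤ.0ℤ
... | fwd = (if [ tail G e ≟ᵛ v ] then ℤ.1ℤ else ℤ.0ℤ) ℤ.- (if [ head G e ≟ᵛ v ] then ℤ.1ℤ else ℤ.0ℤ)
... | bwd = (if [ head G e ≟ᵛ v ] then ℤ.1ℤ else ℤ.0ℤ) ℤ.- (if [ tail G e ≟ᵛ v ] then ℤ.1ℤ else ℤ.0ℤ)

-- An oriented cycle: a set of edges with an orientation of each of them such
-- that every vertex has equal indegree and outdegree.
IsOrientedCycle : (G : Graph) → (Fin (m G) → Dir) → Set
IsOrientedCycle G C = ∀ (v : Fin (n G)) → sumℤ (outMinusIn G C v) ≡ ℤ.0ℤ

OrientedCycle : Graph → Set
OrientedCycle G = Σ (Fin (m G) → Dir) (IsOrientedCycle G)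

ExactlyOne : ∀ {k} → (Fin k → Set) → Set
ExactlyOne {k} P = Σ (Fin k) λ i → P i × (∀ j → P j → j ≡ i)

-- A 4-OCDC: 4 oriented cycles (a family indexed by Fin 4, i.e. a multiset)
-- such that each edge occurs in each of its two orientations in exactly one
-- of the cycles.
FourOCDC : Graph → Set
FourOCDC G =
  Σ (Fin 4 → OrientedCycle G) λ C →
    ∀ (e : Fin (m G)) →
      ExactlyOne (λ i → Data.Product.proj₁ (C i) e ≡ fwd)
    × ExactlyOne (λ i → Data.Product.proj₁ (C i) e ≡ bwd)

ℚ² : Set
ℚ² = ℚ × ℚ

_+²_ : ℚ² → ℚ² → ℚ²
(a , b) +² (c , d) = (a + c , b + d)

_-²_ : ℚ² → ℚ² → ℚ²
(a , b) -² (c , d) = (a - c , b - d)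

0² : ℚ²
0² = (0ℚ , 0ℚ)

sum² : ∀ {k} → (Fin k → ℚ²) → ℚ²
sum² {zero}  f = 0²
sum² {suc k} f = f zero +² sum² (λ i → f (suc i))

norm₁ : ℚ² → ℚ
norm₁ (a , b) = ∣ a ∣ + ∣ b ∣

norm∞ : ℚ² → ℚ
norm∞ (a , b) = ∣ a ∣ ⊔ ∣ b ∣

-- An ℚ²-flow: an orientation of the edges (true = tail → head,
-- false = head → tail) and a value φ(e) on each edge, satisfying flow
-- conservation at every vertex (inflow = outflow).
startOf endOf : (G : Graph) → (Fin (m G) → Bool) → Fin (m G) → Fin (n G)
startOf G o e = if o e then tail G e else head G e
endOf   G o e = if o e then head G e else tail G e

record Flow (G : Graph) : Set where
  field
    orient : Fin (m G) → Bool
    φ      : Fin (m G) → ℚ²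
    conservation : ∀ (v : Fin (n G)) →
      sum² (λ e → if [ endOf G orient e ≟ᵛ v ] then φ e else 0²)
        ≡ sum² (λ e → if [ startOf G orient e ≟ᵛ v ] then φ e else 0²)
open Flow public

IsMNZF : (G : Graph) → ℚ → Flow G → Set
IsMNZF G r F = ∀ e → (1ℚ ≤ norm₁ (φ F e)) × (norm₁ (φ F e) ≤ r - 1ℚ)

IsChNZF : (G : Graph) → ℚ → Flow G → Set
IsChNZF G r F = ∀ e → (1ℚ ≤ norm∞ (φ F e)) × (norm∞ (φ F e) ≤ r - 1ℚ)

-- Φ_2^p(G) = 2, where Φ_2^p(G) = inf { r ≥ 2 | an (r,2)-flow exists }.
-- Since the defining set is upward closed in r and every member is ≥ 2,
-- the infimum equals 2 iff a flow exists for every r > 2 (rational r suffice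
-- by density).
Φ₂¹≡2 : Graph → Set
Φ₂¹≡2 G = ∀ (r : ℚ) → (1ℚ + 1ℚ) < r → Σ (Flow G) (IsMNZF G r)

Φ₂∞≡2 : Graph → Set
Φ₂∞≡2 G = ∀ (r : ℚ) → (1ℚ + 1ℚ) < r → Σ (Flow G) (IsChNZF G r)

-- Weight the four cycles of the cover by four vectors w₀, …, w₃ of the plane and
-- superpose them.  A sum of circulations is a circulation, and every edge, lying in
-- exactly one cycle in each direction, carries wᵢ − wⱼ for some i ≠ j.  If the wᵢ
-- are the vertices of the ℓ₁-sphere of radius ½, or the corners of the unit square,
-- all these differences have Manhattan, resp. Chebyshev, norm exactly 1, so the
-- superposition is an (r,2)-flow for every r > 2.
module Submission where

open import Defs
open import Data.Product using (_×_)

open import Algebra.Bundles using (CommutativeRing)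
open import Data.Bool using (Bool; true; false; if_then_else_)
open import Data.Empty using (⊥-elim)
open import Data.Fin using (Fin; zero; suc; punchIn)
open import Data.Nat using (zero; suc)
open import Data.Fin.Properties using (punchInᵢ≢i)
open import Data.Integer as ℤ using (ℤ)
open import Data.Product using (Σ; ∃₂; _,_; proj₁; proj₂)
open import Data.Rational using (ℚ; 0ℚ; 1ℚ; _+_; _-_; _*_; -_; _≤_; _<_; _/_)
open import Data.Rational.Literals using (fromℤ)
import Data.Rational.Properties as ℚP
import Data.Rational.Unnormalised.Base as ℚᵘ
import Data.Rational.Unnormalised.Properties as ℚᵘP
open import Data.Rational.Solver using (module +-*-Solver)
import Data.Integer.Solver as ℤSolver
open import Function using (_∘_)
open import Relation.Binary.PropositionalEquality

open import Algebra.Properties.Semiring.Sum (CommutativeRing.semiring ℚP.+-*-commutativeRing)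
  using (sum; sum-cong-≗; sum-remove; sum-replicate-zero; ∑-comm; ∑-distrib-+; *-distribˡ-sum)

open ≡-Reasoning

fromℤ-+ : ∀ a b → fromℤ (a ℤ.+ b) ≡ fromℤ a + fromℤ b
fromℤ-+ a b =
  ℚP.toℚᵘ-injective (ℚᵘP.≃-trans (ℚᵘ.*≡* (scaled a b)) (ℚᵘP.≃-sym (ℚP.toℚᵘ-homo-+ (fromℤ a) (fromℤ b))))
  where
  open ℤSolver.+-*-Solver
  scaled : ∀ a b → (a ℤ.+ b) ℤ.* ℤ.1ℤ ≡ (a ℤ.* ℤ.1ℤ ℤ.+ b ℤ.* ℤ.1ℤ) ℤ.* ℤ.1ℤ
  scaled = solve 2 (λ a b → (a :+ b) :* con ℤ.1ℤ := (a :* con ℤ.1ℤ :+ b :* con ℤ.1ℤ) :* con ℤ.1ℤ) refl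

fromℤ-sumℤ : ∀ {k} (f : Fin k → ℤ) → fromℤ (sumℤ f) ≡ sum (fromℤ ∘ f)
fromℤ-sumℤ {zero}  f = refl
fromℤ-sumℤ {suc k} f = trans (fromℤ-+ (f zero) (sumℤ (f ∘ suc))) (cong (fromℤ (f zero) +_) (fromℤ-sumℤ (f ∘ suc)))

sum-single : ∀ {k} (i : Fin k) (f : Fin k → ℚ) → (∀ j → j ≢ i → f j ≡ 0ℚ) → sum f ≡ f i
sum-single {suc k} i f vanishes = begin
  sum f                                ≡⟨ sum-remove f ⟩
  f i + sum (f ∘ punchIn i)            ≡⟨ cong (f i +_) (sum-cong-≗ (λ j → vanishes _ (punchInᵢ≢i i j))) ⟩
  f i + sum {k} (λ _ → 0ℚ)             ≡⟨ cong (f i +_) (sum-replicate-zero k) ⟩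
  f i + 0ℚ                             ≡⟨ ℚP.+-identityʳ (f i) ⟩
  f i                                  ∎

indicator : Bool → ℚ
indicator true  = 1ℚ
indicator false = 0ℚ

masked : ∀ b (p : ℚ²) → (if b then p else 0²) ≡ (indicator b * proj₁ p , indicator b * proj₂ p)
masked true  (x , y) = sym (cong₂ _,_ (ℚP.*-identityˡ x) (ℚP.*-identityˡ y))
masked false (x , y) = sym (cong₂ _,_ (ℚP.*-zeroˡ x) (ℚP.*-zeroˡ y))

sum²-masked : ∀ {k} (b : Fin k → Bool) (f g : Fin k → ℚ) →
  sum² (λ e → if b e then (f e , g e) else 0²)
    ≡ (sum (λ e → indicator (b e) * f e) , sum (λ e → indicator (b e) * g e))
sum²-masked {zero}  b f g = refl
sum²-masked {suc k} b f g
  rewrite masked (b zero) (f zero , g zero) | sum²-masked (b ∘ suc) (f ∘ suc) (g ∘ suc) = refl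

forward backward : Dir → ℚ
forward fwd = 1ℚ
forward _   = 0ℚ
backward bwd = 1ℚ
backward _   = 0ℚ

forward-≢ : ∀ {d} → d ≢ fwd → forward d ≡ 0ℚ
forward-≢ {absent} _ = refl
forward-≢ {fwd}    d≢fwd = ⊥-elim (d≢fwd refl)
forward-≢ {bwd}    _ = refl

backward-≢ : ∀ {d} → d ≢ bwd → backward d ≡ 0ℚ
backward-≢ {absent} _ = refl
backward-≢ {fwd}    _ = refl
backward-≢ {bwd}    d≢bwd = ⊥-elim (d≢bwd refl)

sign : Dir → ℚ
sign d = forward d - backward d

module _ (G : Graph) where

  incidence : Fin (n G) → Fin (m G) → ℚ
  incidence v e = indicator [ tail G e ≟ᵛ v ] - indicator [ head G e ≟ᵛ v ]

  IsCirculation : (Fin (m G) → ℚ) → Set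
  IsCirculation f = ∀ v → sum (λ e → incidence v e * f e) ≡ 0ℚ

  incidence-sign : ∀ C v e → incidence v e * sign (C e) ≡ fromℤ (outMinusIn G C v e)
  incidence-sign C v e with C e
  ... | absent = ℚP.*-zeroʳ (incidence v e)
  ... | fwd with [ tail G e ≟ᵛ v ] | [ head G e ≟ᵛ v ]
  ...   | true  | true  = refl
  ...   | true  | false = refl
  ...   | false | true  = refl
  ...   | false | false = refl
  incidence-sign C v e | bwd with [ tail G e ≟ᵛ v ] | [ head G e ≟ᵛ v ]
  ...   | true  | true  = refl
  ...   | true  | false = refl
  ...   | false | true  = refl
  ...   | false | false = refl

  orientedCycle-isCirculation : ∀ C → IsOrientedCycle G C → IsCirculation (sign ∘ C)
  orientedCycle-isCirculation C isCycle v = begin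
    sum (λ e → incidence v e * sign (C e))  ≡⟨ sum-cong-≗ (incidence-sign C v) ⟩
    sum (fromℤ ∘ outMinusIn G C v)          ≡⟨ fromℤ-sumℤ (outMinusIn G C v) ⟨
    fromℤ (sumℤ (outMinusIn G C v))         ≡⟨ cong fromℤ (isCycle v) ⟩
    0ℚ                                      ∎

  sum-isCirculation : ∀ {K} (w : Fin K → ℚ) (f : Fin K → Fin (m G) → ℚ) →
    (∀ k → IsCirculation (f k)) → IsCirculation (λ e → sum (λ k → w k * f k e))
  sum-isCirculation {K} w f circulates v = begin
    sum (λ e → incidence v e * sum (λ k → w k * f k e))
      ≡⟨ sum-cong-≗ (λ e → *-distribˡ-sum (incidence v e) (λ k → w k * f k e)) ⟩
    sum (λ e → sum (λ k → incidence v e * (w k * f k e)))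
      ≡⟨ ∑-comm (λ e k → incidence v e * (w k * f k e)) ⟩
    sum (λ k → sum (λ e → incidence v e * (w k * f k e)))
      ≡⟨ sum-cong-≗ (λ k → sum-cong-≗ (λ e → leftCommute (incidence v e) (w k) (f k e))) ⟩
    sum (λ k → sum (λ e → w k * (incidence v e * f k e)))
      ≡⟨ sum-cong-≗ (λ k → *-distribˡ-sum (w k) (λ e → incidence v e * f k e)) ⟨
    sum (λ k → w k * sum (λ e → incidence v e * f k e))
      ≡⟨ sum-cong-≗ (λ k → trans (cong (w k *_) (circulates k v)) (ℚP.*-zeroʳ (w k))) ⟩
    sum {K} (λ _ → 0ℚ)
      ≡⟨ sum-replicate-zero K ⟩
    0ℚ ∎
    where
    open +-*-Solver
    leftCommute : ∀ x y z → x * (y * z) ≡ y * (x * z)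
    leftCommute = solve 3 (λ x y z → x :* (y :* z) := y :* (x :* z)) refl

  inflow≡outflow : ∀ {f} → IsCirculation f → ∀ v →
    sum (λ e → indicator [ head G e ≟ᵛ v ] * f e) ≡ sum (λ e → indicator [ tail G e ≟ᵛ v ] * f e)
  inflow≡outflow {f} circulates v = begin
    sum (λ e → H e * f e)                                 ≡⟨ ℚP.+-identityʳ _ ⟨
    sum (λ e → H e * f e) + 0ℚ                            ≡⟨ cong (sum (λ e → H e * f e) +_) (circulates v) ⟨
    sum (λ e → H e * f e) + sum (λ e → incidence v e * f e) ≡⟨ ∑-distrib-+ (λ e → H e * f e) (λ e → incidence v e * f e) ⟨
    sum (λ e → H e * f e + incidence v e * f e)           ≡⟨ sum-cong-≗ (λ e → recombine (T e) (H e) (f e)) ⟩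
    sum (λ e → T e * f e)                                 ∎
    where
    open +-*-Solver
    T H : Fin (m G) → ℚ
    T e = indicator [ tail G e ≟ᵛ v ]
    H e = indicator [ head G e ≟ᵛ v ]
    recombine : ∀ t h x → h * x + (t - h) * x ≡ t * x
    recombine = solve 3 (λ t h x → h :* x :+ (t :- h) :* x := t :* x) refl

  circulationFlow : (f g : Fin (m G) → ℚ) → IsCirculation f → IsCirculation g → Flow G
  circulationFlow f g f-circulates g-circulates = record
    { orient       = λ _ → true
    ; φ            = λ e → (f e , g e)
    ; conservation = λ v → begin
        sum² (λ e → if [ head G e ≟ᵛ v ] then (f e , g e) else 0²)
          ≡⟨ sum²-masked (λ e → [ head G e ≟ᵛ v ]) f g ⟩
        _ ≡⟨ cong₂ _,_ (inflow≡outflow f-circulates v) (inflow≡outflow g-circulates v) ⟩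
        _ ≡⟨ sum²-masked (λ e → [ tail G e ≟ᵛ v ]) f g ⟨
        sum² (λ e → if [ tail G e ≟ᵛ v ] then (f e , g e) else 0²) ∎
    }

*-sign : ∀ x d → x * sign d ≡ x * forward d + - 1ℚ * (x * backward d)
*-sign x d = solve 3 (λ x f b → x :* (f :- b) := x :* f :+ con (- 1ℚ) :* (x :* b)) refl x (forward d) (backward d)
  where open +-*-Solver

module _ (G : Graph) {K} (C : Fin K → OrientedCycle G) where

  private
    D : Fin K → Fin (m G) → Dir
    D k = proj₁ (C k)

  combination : (Fin K → ℚ) → Fin (m G) → ℚ
  combination w e = sum (λ k → w k * sign (D k e))

  combinationFlow : (Fin K → ℚ²) → Flow G
  combinationFlow w = circulationFlow G (combination (λ k → proj₁ (w k))) (combination (λ k → proj₂ (w k)))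
    (circulates (λ k → proj₁ (w k))) (circulates (λ k → proj₂ (w k)))
    where
    circulates : ∀ w → IsCirculation G (combination w)
    circulates w = sum-isCirculation G w (λ k → sign ∘ D k)
      (λ k → orientedCycle-isCirculation G (D k) (proj₂ (C k)))

  DoublyCovered : Fin (m G) → Set
  DoublyCovered e = ExactlyOne (λ k → D k e ≡ fwd) × ExactlyOne (λ k → D k e ≡ bwd)

  combination-doublyCovered : ∀ w e {i j} →
    D i e ≡ fwd → (∀ k → D k e ≡ fwd → k ≡ i) →
    D j e ≡ bwd → (∀ k → D k e ≡ bwd → k ≡ j) →
    combination w e ≡ w i - w j
  combination-doublyCovered w e {i} {j} Dᵢ≡fwd only-i Dⱼ≡bwd only-j = begin
    sum (λ k → w k * sign (D k e))
      ≡⟨ sum-cong-≗ (λ k → *-sign (w k) (D k e)) ⟩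
    sum (λ k → F k + - 1ℚ * B k)
      ≡⟨ ∑-distrib-+ F (λ k → - 1ℚ * B k) ⟩
    sum F + sum (λ k → - 1ℚ * B k)
      ≡⟨ cong (sum F +_) negate ⟨
    sum F + - 1ℚ * sum B
      ≡⟨ cong₂ (λ x y → x + - 1ℚ * y) (sum-single i F F-vanishes) (sum-single j B B-vanishes) ⟩
    w i * forward (D i e) + - 1ℚ * (w j * backward (D j e))
      ≡⟨ cong₂ (λ d d′ → w i * forward d + - 1ℚ * (w j * backward d′)) Dᵢ≡fwd Dⱼ≡bwd ⟩
    w i * 1ℚ + - 1ℚ * (w j * 1ℚ)
      ≡⟨ difference (w i) (w j) ⟩
    w i - w j ∎
    where
    difference : ∀ x y → x * 1ℚ + - 1ℚ * (y * 1ℚ) ≡ x - y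
    difference = solve 2 (λ x y → x :* con 1ℚ :+ con (- 1ℚ) :* (y :* con 1ℚ) := x :- y) refl
      where open +-*-Solver
    F B : Fin K → ℚ
    F k = w k * forward (D k e)
    B k = w k * backward (D k e)
    negate : - 1ℚ * sum B ≡ sum (λ k → - 1ℚ * B k)
    negate = *-distribˡ-sum (- 1ℚ) B
    F-vanishes : ∀ k → k ≢ i → F k ≡ 0ℚ
    F-vanishes k k≢i = trans (cong (w k *_) (forward-≢ (k≢i ∘ only-i k))) (ℚP.*-zeroʳ (w k))
    B-vanishes : ∀ k → k ≢ j → B k ≡ 0ℚ
    B-vanishes k k≢j = trans (cong (w k *_) (backward-≢ (k≢j ∘ only-j k))) (ℚP.*-zeroʳ (w k))

  combinationFlow-doublyCovered : ∀ w e → DoublyCovered e →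
    ∃₂ λ i j → i ≢ j × φ (combinationFlow w) e ≡ w i -² w j
  combinationFlow-doublyCovered w e ((i , Dᵢ≡fwd , only-i) , (j , Dⱼ≡bwd , only-j)) =
    i , j , i≢j ,
    cong₂ _,_ first second
    where
    first : combination (λ k → proj₁ (w k)) e ≡ proj₁ (w i) - proj₁ (w j)
    first = combination-doublyCovered (λ k → proj₁ (w k)) e {i} {j} Dᵢ≡fwd only-i Dⱼ≡bwd only-j
    second : combination (λ k → proj₂ (w k)) e ≡ proj₂ (w i) - proj₂ (w j)
    second = combination-doublyCovered (λ k → proj₂ (w k)) e {i} {j} Dᵢ≡fwd only-i Dⱼ≡bwd only-j
    i≢j : i ≢ j
    i≢j refl with trans (sym Dᵢ≡fwd) Dⱼ≡bwd
    ... | ()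

  doubleCover-unitFlow : (N : ℚ² → ℚ) (w : Fin K → ℚ²) → (∀ i j → i ≢ j → N (w i -² w j) ≡ 1ℚ) →
    (∀ e → DoublyCovered e) → Σ (Flow G) λ F → ∀ e → N (φ F e) ≡ 1ℚ
  doubleCover-unitFlow N w separated covered = combinationFlow w , unit
    where
    unit : ∀ e → N (φ (combinationFlow w) e) ≡ 1ℚ
    unit e =
      let i , j , i≢j , φₑ≡wᵢ-wⱼ = combinationFlow-doublyCovered w e (covered e)
      in trans (cong N φₑ≡wᵢ-wⱼ) (separated i j i≢j)

½ : ℚ
½ = ℤ.+ 1 / 2

diamond : Fin 4 → ℚ²
diamond zero                   = (½ , 0ℚ)
diamond (suc zero)             = (- ½ , 0ℚ)
diamond (suc (suc zero))       = (0ℚ , ½)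
diamond (suc (suc (suc zero))) = (0ℚ , - ½)

square : Fin 4 → ℚ²
square zero                   = (0ℚ , 0ℚ)
square (suc zero)             = (1ℚ , 0ℚ)
square (suc (suc zero))       = (0ℚ , 1ℚ)
square (suc (suc (suc zero))) = (1ℚ , 1ℚ)

diamond-separated : ∀ i j → i ≢ j → norm₁ (diamond i -² diamond j) ≡ 1ℚ
diamond-separated zero                   zero                   i≢j = ⊥-elim (i≢j refl)
diamond-separated zero                   (suc zero)             _   = refl
diamond-separated zero                   (suc (suc zero))       _   = refl
diamond-separated zero                   (suc (suc (suc zero))) _   = refl
diamond-separated (suc zero)             zero                   _   = refl
diamond-separated (suc zero)             (suc zero)             i≢j = ⊥-elim (i≢j refl)
diamond-separated (suc zero)             (suc (suc zero))       _   = refl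
diamond-separated (suc zero)             (suc (suc (suc zero))) _   = refl
diamond-separated (suc (suc zero))       zero                   _   = refl
diamond-separated (suc (suc zero))       (suc zero)             _   = refl
diamond-separated (suc (suc zero))       (suc (suc zero))       i≢j = ⊥-elim (i≢j refl)
diamond-separated (suc (suc zero))       (suc (suc (suc zero))) _   = refl
diamond-separated (suc (suc (suc zero))) zero                   _   = refl
diamond-separated (suc (suc (suc zero))) (suc zero)             _   = refl
diamond-separated (suc (suc (suc zero))) (suc (suc zero))       _   = refl
diamond-separated (suc (suc (suc zero))) (suc (suc (suc zero))) i≢j = ⊥-elim (i≢j refl)

square-separated : ∀ i j → i ≢ j → norm∞ (square i -² square j) ≡ 1ℚ
square-separated zero                   zero                   i≢j = ⊥-elim (i≢j refl)
square-separated zero                   (suc zero)             _   = refl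
square-separated zero                   (suc (suc zero))       _   = refl
square-separated zero                   (suc (suc (suc zero))) _   = refl
square-separated (suc zero)             zero                   _   = refl
square-separated (suc zero)             (suc zero)             i≢j = ⊥-elim (i≢j refl)
square-separated (suc zero)             (suc (suc zero))       _   = refl
square-separated (suc zero)             (suc (suc (suc zero))) _   = refl
square-separated (suc (suc zero))       zero                   _   = refl
square-separated (suc (suc zero))       (suc zero)             _   = refl
square-separated (suc (suc zero))       (suc (suc zero))       i≢j = ⊥-elim (i≢j refl)
square-separated (suc (suc zero))       (suc (suc (suc zero))) _   = refl
square-separated (suc (suc (suc zero))) zero                   _   = refl
square-separated (suc (suc (suc zero))) (suc zero)             _   = refl
square-separated (suc (suc (suc zero))) (suc (suc zero))       _   = refl
square-separated (suc (suc (suc zero))) (suc (suc (suc zero))) i≢j = ⊥-elim (i≢j refl)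

1≤x≤r-1 : ∀ {r x} → 1ℚ + 1ℚ < r → x ≡ 1ℚ → (1ℚ ≤ x) × (x ≤ r - 1ℚ)
1≤x≤r-1 2<r refl = ℚP.≤-refl , ℚP.+-monoˡ-≤ (- 1ℚ) (ℚP.<⇒≤ 2<r)

proposition14 : (G : Graph) → FourOCDC G → Φ₂¹≡2 G × Φ₂∞≡2 G
proposition14 G (C , covered) = flowFor norm₁ diamond diamond-separated , flowFor norm∞ square square-separated
  where
  flowFor : (N : ℚ² → ℚ) (w : Fin 4 → ℚ²) → (∀ i j → i ≢ j → N (w i -² w j) ≡ 1ℚ) →
    ∀ r → 1ℚ + 1ℚ < r → Σ (Flow G) λ F → ∀ e → (1ℚ ≤ N (φ F e)) × (N (φ F e) ≤ r - 1ℚ)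
  flowFor N w separated r 2<r =
    let F , unit = doubleCover-unitFlow G C N w separated covered in F , λ e → 1≤x≤r-1 2<r (unit e)
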